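{- If $n\ge 3$ is an integer, then $\mathrm{rc}(S(n,3))=3\cdot 2^{n-2}-1$.
   Context: For integers $n\ge 0$, $k\ge 1$, the Sierpiński graph $S(n,k)$ has vertex set $[k]^n$ (words of length $n$ over $[k]=\{1,\dots,k\}$) and edges defined recursively: $E(S(0,k))=\emptyset$ and $E(S(n,k))=\{\{ix,iy\} \mid i\in[k], \{x,y\}\in E(S(n-1,k))\}\cup\{\{ij^{n-1},ji^{n-1}\} \mid i,j\in[k], i\ne j\}$. Cop and robber game with radius of capture $r$: first the cop chooses a vertex, then the robber; afterwards, starting with the cop, the players alternately either move to an adjacent vertex or stay put, both knowing both positions. The cop wins if at some point the distance between the players is at most $r$. $\mathcal{CWRC}(r)$ is the class of graphs on which the cop has a winning strategy. $\mathrm{rc}(G)=\min\{r\in\mathbb{N}_0 \mid G\in\mathcal{CWRC}(r)\}$. -}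

module Defs where

open import Data.Nat using (ℕ; zero; suc; _≤_)
open import Data.Fin using (Fin)
open import Data.Vec using (Vec; []; _∷_; replicate)
open import Data.Product using (Σ; ∃; _×_; _,_)
open import Data.Sum using (_⊎_)
open import Relation.Binary.PropositionalEquality using (_≡_; _≢_)

Vertex : ℕ → ℕ → Set
Vertex n k = Vec (Fin k) n

-- Edge relation of S(n,k), following the recursive definition:
--   {ix, iy} for {x,y} an edge of S(n-1,k), and
--   {i j^{n-1}, j i^{n-1}} for i ≠ j.
-- (Both orientations of the bridge edges are included since i, j range over all pairs.)
data SAdj {k : ℕ} : {n : ℕ} → Vertex n k → Vertex n k → Set where
  inner  : {n : ℕ} {x y : Vertex n k} (i : Fin k) →
           SAdj x y → SAdj (i ∷ x) (i ∷ y)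
  bridge : {n : ℕ} (i j : Fin k) → i ≢ j →
           SAdj {k} {suc n} (i ∷ replicate n j) (j ∷ replicate n i)

record Graph : Set₁ where
  field
    V   : Set
    Adj : V → V → Set
open Graph public

S : ℕ → ℕ → Graph
S n k = record { V = Vertex n k ; Adj = SAdj }

module _ (G : Graph) where

  data Walk : ℕ → V G → V G → Set where
    here : {x : V G} → Walk zero x x
    next : {m : ℕ} {x y z : V G} → Adj G x y → Walk m y z → Walk (suc m) x z

  DistLe : V G → V G → ℕ → Set
  DistLe x y r = Σ ℕ λ m → m ≤ r × Walk m x y

  Step : V G → V G → Set
  Step x y = x ≡ y ⊎ Adj G x y

  -- CopWin r c b : in the position where the cop is at c, the robber at b and
  -- the cop is to move, the cop can force capture (distance ≤ r) in finitely
  -- many rounds.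
  data CopWin (r : ℕ) : V G → V G → Set where
    caught : {c b : V G} → DistLe c b r → CopWin r c b
    move   : {c b : V G} (c' : V G) → Step c c' →
             (DistLe c' b r ⊎ ((b' : V G) → Step b b' → CopWin r c' b')) →
             CopWin r c b

  CWRC : ℕ → Set
  CWRC r = Σ (V G) λ c → (b : V G) → CopWin r c b

  IsRC : ℕ → Set
  IsRC m = CWRC m × ((r : ℕ) → CWRC r → m ≤ r)

-- Upper bound: S(n,k) has diameter 2ⁿ − 1, so every vertex lies within 3·2ⁿ⁻² of 0 1 2ⁿ⁻², and the
-- cop's first step towards the robber brings him within 3·2ⁿ⁻² − 1.
-- Lower bound: the robber answers each cop position c by a vertex evade c at distance at least 3·2ⁿ⁻²
-- from c, where evade turns every move of the cop into a move or a pause of the robber, so the robber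
-- can always stay at evade c. Distances are bounded from below by the explicit distance formula of
-- S(n,3) in terms of distances to extreme vertices, which vanishes on the diagonal and changes by at
-- most one along an edge.
module Submission where

open import Defs
open import Algebra.Properties.CommutativeSemigroup using (x∙yz≈y∙xz)
open import Data.Empty using (⊥)
open import Data.Fin using (Fin; _≟_)
open import Data.Fin.Patterns using (0F; 1F; 2F)
open import Data.Fin.Properties using (all?)
open import Data.Nat using (ℕ; zero; suc; pred; _+_; _*_; _∸_; _^_; _≤_; _<_; _⊓_; z≤n; s≤s)
open import Data.Nat.Properties hiding (_≟_)
open import Data.Nat.Tactic.RingSolver using (solve-∀)
open import Data.Product using (_,_)
open import Data.Sum using (_⊎_; inj₁; inj₂)
open import Data.Vec using ([]; _∷_; replicate; map)
open import Data.Vec.Properties using (map-replicate)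
open import Function using (_∘_)
open import Relation.Binary.PropositionalEquality
open import Relation.Nullary using (¬_; ¬?; yes; no; contradiction)
open import Relation.Nullary.Decidable using (from-yes; _→-dec_)

private
  variable
    k k′ m n r a b : ℕ

-- Walks and the game on an arbitrary graph

module _ {G : Graph} where

  DistLe-refl : ∀ {x} → DistLe G x x 0
  DistLe-refl = 0 , z≤n , here

  Step⇒DistLe : ∀ {x y} → Step G x y → DistLe G x y 1
  Step⇒DistLe (inj₁ refl) = 0 , z≤n , here
  Step⇒DistLe (inj₂ e)    = 1 , s≤s z≤n , next e here

  DistLe-mono : ∀ {x y} → a ≤ b → DistLe G x y a → DistLe G x y b
  DistLe-mono a≤b (ℓ , ℓ≤a , w) = ℓ , ≤-trans ℓ≤a a≤b , w

  _++ʷ_ : ∀ {x y z} → Walk G a x y → Walk G b y z → Walk G (a + b) x z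
  here     ++ʷ w′ = w′
  next e w ++ʷ w′ = next e (w ++ʷ w′)

  DistLe-trans : ∀ {x y z} → DistLe G x y a → DistLe G y z b → DistLe G x z (a + b)
  DistLe-trans (ℓ , ℓ≤a , w) (ℓ′ , ℓ′≤b , w′) = ℓ + ℓ′ , +-mono-≤ ℓ≤a ℓ′≤b , w ++ʷ w′

  lipschitz⇒≤length : (d : V G → V G → ℕ) → (∀ x → d x x ≡ 0) →
                      (∀ {x x′} y → Adj G x x′ → d x y ≤ suc (d x′ y)) →
                      ∀ {ℓ x y} → Walk G ℓ x y → d x y ≤ ℓ
  lipschitz⇒≤length d d-refl d-lip {x = x} here = ≤-reflexive (d-refl x)
  lipschitz⇒≤length d d-refl d-lip {y = y} (next e w) =
    ≤-trans (d-lip y e) (s≤s (lipschitz⇒≤length d d-refl d-lip w))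

  center⇒CWRC : (c : V G) → (∀ b → DistLe G c b (suc r)) → CWRC G r
  center⇒CWRC c near = c , win
    where
    win : ∀ b → CopWin G _ c b
    win b with near b
    ... | zero  , _      , w        = caught (0 , z≤n , w)
    ... | suc ℓ , ℓ<1+r , next e w = move _ (inj₂ e) (inj₁ (ℓ , ≤-pred ℓ<1+r , w))

  evasion⇒¬CWRC : (ρ : V G → V G) → (∀ {c c′} → Step G c c′ → Step G (ρ c) (ρ c′)) →
                  (∀ c → ¬ DistLe G c (ρ c) (suc r)) → ¬ CWRC G r
  evasion⇒¬CWRC {r} ρ ρ-step far (c , win) = escape (win (ρ c))
    where
    escape : ∀ {c} → CopWin G r c (ρ c) → ⊥
    escape {c} (caught near) = far c (DistLe-mono (n≤1+n r) near)
    escape (move c′ s (inj₁ near)) =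
      far c′ (DistLe-mono (≤-reflexive (+-comm r 1)) (DistLe-trans near (Step⇒DistLe (ρ-step s))))
    escape (move c′ s (inj₂ play)) = escape (play (ρ c′) (ρ-step s))

-- Sierpiński graphs S(n,k)

SAdj-sym : {x y : Vertex n k} → SAdj x y → SAdj y x
SAdj-sym (inner i e)      = inner i (SAdj-sym e)
SAdj-sym (bridge i j i≢j) = bridge j i (i≢j ∘ sym)

Step-sym : {x y : Vertex n k} → Step (S n k) x y → Step (S n k) y x
Step-sym (inj₁ refl) = inj₁ refl
Step-sym (inj₂ e)    = inj₂ (SAdj-sym e)

Step-∷ : (i : Fin k) {x y : Vertex n k} → Step (S n k) x y → Step (S (suc n) k) (i ∷ x) (i ∷ y)
Step-∷ i (inj₁ refl) = inj₁ refl
Step-∷ i (inj₂ e)    = inj₂ (inner i e)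

SAdj-map : (g : Fin k → Fin k′) {x y : Vertex n k} → SAdj x y → Step (S n k′) (map g x) (map g y)
SAdj-map g (inner i e) = Step-∷ (g i) (SAdj-map g e)
SAdj-map g (bridge {n} i j _) rewrite map-replicate g j n | map-replicate g i n with g i ≟ g j
... | yes gi≡gj rewrite gi≡gj = inj₁ refl
... | no  gi≢gj = inj₂ (bridge (g i) (g j) gi≢gj)

DistLe-∷ : (i : Fin k) {x y : Vertex n k} → DistLe (S n k) x y a → DistLe (S (suc n) k) (i ∷ x) (i ∷ y) a
DistLe-∷ i (ℓ , ℓ≤a , w) = ℓ , ℓ≤a , lift w
  where
  lift : ∀ {ℓ x y} → Walk (S _ _) ℓ x y → Walk (S _ _) ℓ (i ∷ x) (i ∷ y)
  lift here       = here
  lift (next e w) = next (inner i e) (lift w)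

2^[1+n]≡2^n+2^n : ∀ n → 2 ^ suc n ≡ 2 ^ n + 2 ^ n
2^[1+n]≡2^n+2^n n = cong (2 ^ n +_) (+-identityʳ (2 ^ n))

diameter : (x y : Vertex n k) → DistLe (S n k) x y (pred (2 ^ n))
diameter [] [] = DistLe-refl
diameter {n = suc n} (i ∷ x) (j ∷ y) with i ≟ j
... | yes refl = DistLe-mono (pred-mono-≤ (m≤m+n (2 ^ n) _)) (DistLe-∷ i (diameter x y))
... | no  i≢j  = DistLe-mono (≤-reflexive lengths)
  (DistLe-trans (DistLe-∷ i (diameter x (replicate n j)))
    (DistLe-trans (Step⇒DistLe (inj₂ (bridge i j i≢j))) (DistLe-∷ j (diameter (replicate n i) y))))
  where
  lengths : pred (2 ^ n) + suc (pred (2 ^ n)) ≡ pred (2 ^ suc n)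
  lengths = cong pred (trans (cong₂ _+_ 1+pred 1+pred) (sym (2^[1+n]≡2^n+2^n n)))
    where 1+pred = suc-pred (2 ^ n) {{m^n≢0 2 n}}

-- extDist j x = d(x, jⁿ), the distance to the extreme vertex jⁿ.
extDist : Fin k → Vertex n k → ℕ
extDist j [] = 0
extDist {n = suc n} j (i ∷ x) with i ≟ j
... | yes _ = extDist j x
... | no  _ = 2 ^ n + extDist j x

extDist-≡ : {j : Fin k} {x : Vertex n k} → extDist j (j ∷ x) ≡ extDist j x
extDist-≡ {j = j} with j ≟ j
... | yes _   = refl
... | no  j≢j = contradiction refl j≢j

extDist-≢ : {i j : Fin k} {x : Vertex n k} → i ≢ j → extDist j (i ∷ x) ≡ 2 ^ n + extDist j x
extDist-≢ {i = i} {j} i≢j with i ≟ j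
... | yes i≡j = contradiction i≡j i≢j
... | no  _   = refl

extDist-∷-≥ : (i j : Fin k) (x : Vertex n k) → extDist j x ≤ extDist j (i ∷ x)
extDist-∷-≥ {n = n} i j x with i ≟ j
... | yes _ = ≤-refl
... | no  _ = m≤n+m _ (2 ^ n)

extDist-< : (j : Fin k) (x : Vertex n k) → extDist j x < 2 ^ n
extDist-< j [] = s≤s z≤n
extDist-< {n = suc n} j (i ∷ x) with i ≟ j
... | yes _ = <-≤-trans (extDist-< j x) (m≤m+n (2 ^ n) _)
... | no  _ = <-≤-trans (+-monoʳ-< (2 ^ n) (extDist-< j x)) (≤-reflexive (sym (2^[1+n]≡2^n+2^n n)))

extDist-replicate-≡ : ∀ n (j : Fin k) → extDist j (replicate n j) ≡ 0
extDist-replicate-≡ zero    j = refl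
extDist-replicate-≡ (suc n) j = trans (extDist-≡ {x = replicate n j}) (extDist-replicate-≡ n j)

suc-extDist-replicate-≢ : ∀ n {j l : Fin k} → j ≢ l → suc (extDist l (replicate n j)) ≡ 2 ^ n
suc-extDist-replicate-≢ zero    j≢l = refl
suc-extDist-replicate-≢ (suc n) {j} {l} j≢l = begin
  suc (extDist l (j ∷ replicate n j))     ≡⟨ cong suc (extDist-≢ {x = replicate n j} j≢l) ⟩
  suc (2 ^ n + extDist l (replicate n j)) ≡⟨ sym (+-suc (2 ^ n) _) ⟩
  2 ^ n + suc (extDist l (replicate n j)) ≡⟨ cong (2 ^ n +_) (suc-extDist-replicate-≢ n j≢l) ⟩
  2 ^ n + 2 ^ n                           ≡⟨ sym (2^[1+n]≡2^n+2^n n) ⟩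
  2 ^ suc n                               ∎
  where open ≡-Reasoning

extDist-lip : (l : Fin k) {x x′ : Vertex n k} → SAdj x x′ → extDist l x ≤ suc (extDist l x′)
extDist-lip {n = suc n} l (inner i e) with i ≟ l
... | yes _ = extDist-lip l e
... | no  _ = ≤-trans (+-monoʳ-≤ (2 ^ n) (extDist-lip l e)) (≤-reflexive (+-suc (2 ^ n) _))
extDist-lip l (bridge {n} i j i≢j) with i ≟ l | j ≟ l
... | yes refl | yes refl = contradiction refl i≢j
... | yes refl | no  _    = begin
  extDist i (replicate n j)               ≤⟨ <⇒≤ (extDist-< i (replicate n j)) ⟩
  2 ^ n                                   ≤⟨ m≤m+n (2 ^ n) _ ⟩
  2 ^ n + extDist i (replicate n i)       ≤⟨ n≤1+n _ ⟩
  suc (2 ^ n + extDist i (replicate n i)) ∎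
  where open ≤-Reasoning
... | no  _    | yes refl = begin
  2 ^ n + extDist j (replicate n j)       ≡⟨ cong (2 ^ n +_) (extDist-replicate-≡ n j) ⟩
  2 ^ n + 0                               ≡⟨ +-identityʳ (2 ^ n) ⟩
  2 ^ n                                   ≡⟨ sym (suc-extDist-replicate-≢ n i≢j) ⟩
  suc (extDist j (replicate n i))         ∎
  where open ≤-Reasoning
... | no  i≢l  | no  j≢l  = begin
  2 ^ n + extDist l (replicate n j)       ≡⟨ cong (2 ^ n +_) (suc-injective (trans
                                               (suc-extDist-replicate-≢ n j≢l)
                                               (sym (suc-extDist-replicate-≢ n i≢l)))) ⟩
  2 ^ n + extDist l (replicate n i)       ≤⟨ n≤1+n _ ⟩
  suc (2 ^ n + extDist l (replicate n i)) ∎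
  where open ≤-Reasoning

extDist-map-≥ : (j₁ j₂ : Fin k) (g : Fin k → Fin k) → (∀ l → l ≢ j₁ ⊎ g l ≢ j₂) →
                (x : Vertex n k) → 2 ^ n ≤ suc (extDist j₁ x + extDist j₂ (map g x))
extDist-map-≥ j₁ j₂ g sep [] = s≤s z≤n
extDist-map-≥ {n = suc n} j₁ j₂ g sep (l ∷ x) = begin
  2 ^ suc n                                             ≡⟨ 2^[1+n]≡2^n+2^n n ⟩
  2 ^ n + 2 ^ n                                         ≤⟨ +-monoʳ-≤ _ (extDist-map-≥ j₁ j₂ g sep x) ⟩
  2 ^ n + suc (e₁ + e₂)                                 ≡⟨ +-suc (2 ^ n) _ ⟩
  suc (2 ^ n + (e₁ + e₂))                               ≤⟨ s≤s first-letter ⟩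
  suc (extDist j₁ (l ∷ x) + extDist j₂ (g l ∷ map g x)) ∎
  where
  open ≤-Reasoning
  e₁ = extDist j₁ x
  e₂ = extDist j₂ (map g x)
  first-letter : 2 ^ n + (e₁ + e₂) ≤ extDist j₁ (l ∷ x) + extDist j₂ (g l ∷ map g x)
  first-letter with sep l
  ... | inj₁ l≢j₁  = ≤-trans (≤-reflexive (sym (+-assoc (2 ^ n) e₁ e₂)))
                             (+-mono-≤ (≤-reflexive (sym (extDist-≢ l≢j₁))) (extDist-∷-≥ (g l) j₂ _))
  ... | inj₂ gl≢j₂ = ≤-trans (≤-reflexive (x∙yz≈y∙xz +-commutativeSemigroup (2 ^ n) e₁ e₂))
                             (+-mono-≤ (extDist-∷-≥ l j₁ x) (≤-reflexive (sym (extDist-≢ gl≢j₂))))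

-- The distance formula for S(n,3)

Word : ℕ → Set
Word n = Vertex n 3

-- The diagonal value third i i = i is junk.
third : Fin 3 → Fin 3 → Fin 3
third 0F 1F = 2F
third 0F 2F = 1F
third 1F 0F = 2F
third 1F 2F = 0F
third 2F 0F = 1F
third 2F 1F = 0F
third i  _  = i

third-unique : {i j l : Fin 3} → i ≢ j → l ≢ i → l ≢ j → third i j ≡ l
third-unique {i} {j} {l} = from-yes (all? λ i → all? λ j → all? λ l →
  ¬? (i ≟ j) →-dec ¬? (l ≟ i) →-dec ¬? (l ≟ j) →-dec third i j ≟ l) i j l

third-≢ˡ : {i j : Fin 3} → i ≢ j → third i j ≢ i
third-≢ˡ {i} {j} = from-yes (all? λ i → all? λ j → ¬? (i ≟ j) →-dec ¬? (third i j ≟ i)) i j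

third-≢ʳ : {i j : Fin 3} → i ≢ j → third i j ≢ j
third-≢ʳ {i} {j} = from-yes (all? λ i → all? λ j → ¬? (i ≟ j) →-dec ¬? (third i j ≟ j)) i j

-- A shortest path from copy i to copy j either crosses the bridge between them, or passes through
-- the third copy t, whose corners t iⁿ and t jⁿ are 2ⁿ − 1 apart.
crossDist : Fin 3 → Fin 3 → Word n → Word n → ℕ
crossDist {n} i j x y = (extDist j x + suc (extDist i y)) ⊓ (extDist t x + extDist t y + suc (2 ^ n))
  where t = third i j

crossDist-via : {i j t : Fin 3} → i ≢ j → t ≢ i → t ≢ j → (x y : Word n) →
                crossDist i j x y ≡
                (extDist j x + suc (extDist i y)) ⊓ (extDist t x + extDist t y + suc (2 ^ n))
crossDist-via {n} {i} {j} i≢j t≢i t≢j x y =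
  cong (λ t → (extDist j x + suc (extDist i y)) ⊓ (extDist t x + extDist t y + suc (2 ^ n)))
       (third-unique i≢j t≢i t≢j)

-- The distance in S(n,3); only the lower bound dist≤length is needed.
dist : Word n → Word n → ℕ
dist [] [] = 0
dist (i ∷ x) (j ∷ y) with i ≟ j
... | yes _ = dist x y
... | no  _ = crossDist i j x y

dist-≢ : {i j : Fin 3} {x y : Word n} → i ≢ j → dist (i ∷ x) (j ∷ y) ≡ crossDist i j x y
dist-≢ {i = i} {j} i≢j with i ≟ j
... | yes i≡j = contradiction i≡j i≢j
... | no  _   = refl

dist-refl : (x : Word n) → dist x x ≡ 0
dist-refl []      = refl
dist-refl (i ∷ x) with i ≟ i
... | yes _   = dist-refl x
... | no  i≢i = contradiction refl i≢i

dist-replicate : ∀ n (j : Fin 3) (y : Word n) → dist (replicate n j) y ≡ extDist j y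
dist-replicate zero    j []      = refl
dist-replicate (suc n) j (l ∷ y) with j ≟ l
... | yes refl = trans (dist-replicate n j y) (sym (extDist-≡ {x = y}))
... | no  j≢l  = begin
  crossDist j l (replicate n j) y   ≡⟨ direct (suc-extDist-replicate-≢ n j≢l)
                                              (suc-extDist-replicate-≢ n (third-≢ˡ j≢l ∘ sym))
                                              (extDist-< j y) ⟩
  2 ^ n + extDist j y               ≡⟨ sym (extDist-≢ (j≢l ∘ sym)) ⟩
  extDist j (l ∷ y)                 ∎
  where
  open ≡-Reasoning
  direct : ∀ {a b c e P} → suc a ≡ P → suc c ≡ P → b < P → (a + suc b) ⊓ (c + e + suc P) ≡ P + b
  direct {a} {b} {e = e} refl refl (s≤s b≤a) =
    trans (m≤n⇒m⊓n≡m (+-mono-≤ (m≤m+n a e) (s≤s (m≤n⇒m≤1+n b≤a)))) (+-suc a b)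

crossDist-lip : (i j : Fin 3) {x x′ : Word n} (y : Word n) → SAdj x x′ →
                crossDist i j x y ≤ suc (crossDist i j x′ y)
crossDist-lip i j y e =
  ⊓-mono-≤ (+-monoˡ-≤ _ (extDist-lip j e)) (+-monoˡ-≤ _ (+-monoˡ-≤ _ (extDist-lip (third i j) e)))

crossDist-replicate : ∀ n {i j l : Fin 3} → i ≢ l → j ≢ i → j ≢ l → (y : Word n) →
                      crossDist i l (replicate n j) y ≡ (2 ^ n + extDist i y) ⊓ suc (2 ^ n + extDist j y)
crossDist-replicate n {i} {j} {l} i≢l j≢i j≢l y = begin
  crossDist i l jⁿ y
    ≡⟨ crossDist-via i≢l j≢i j≢l jⁿ y ⟩
  (extDist l jⁿ + suc (extDist i y)) ⊓ (extDist j jⁿ + extDist j y + suc (2 ^ n))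
    ≡⟨ cong₂ _⊓_ (trans (+-suc _ _) (cong (_+ extDist i y) (suc-extDist-replicate-≢ n j≢l)))
                 (trans (cong (λ z → z + extDist j y + suc (2 ^ n)) (extDist-replicate-≡ n j))
                        (+-comm (extDist j y) (suc (2 ^ n)))) ⟩
  (2 ^ n + extDist i y) ⊓ suc (2 ^ n + extDist j y)
    ∎
  where
  open ≡-Reasoning
  jⁿ = replicate n j

dist-lip-bridge : ∀ n {i j : Fin 3} → i ≢ j → (y : Word (suc n)) →
                  dist (i ∷ replicate n j) y ≤ suc (dist (j ∷ replicate n i) y)
dist-lip-bridge n {i} {j} i≢j (l ∷ y) with i ≟ l | j ≟ l
... | yes refl | yes refl = contradiction refl i≢j
... | yes refl | no  _    = begin
  dist (replicate n j) y                ≡⟨ dist-replicate n j y ⟩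
  extDist j y                           ≤⟨ ⊓-glb (≤-trans (n≤1+n _) (m≤n+m _ _))
                                            (≤-trans (<⇒≤ (extDist-< j y)) (≤-trans (n≤1+n _) (m≤n+m _ _))) ⟩
  crossDist j i (replicate n i) y       ≤⟨ n≤1+n _ ⟩
  suc (crossDist j i (replicate n i) y) ∎
  where open ≤-Reasoning
... | no  _    | yes refl = begin
  crossDist i j (replicate n j) y
    ≤⟨ m⊓n≤m _ _ ⟩
  extDist j (replicate n j) + suc (extDist i y)
    ≡⟨ cong (_+ suc (extDist i y)) (extDist-replicate-≡ n j) ⟩
  suc (extDist i y)
    ≡⟨ cong suc (sym (dist-replicate n i y)) ⟩
  suc (dist (replicate n i) y)
    ∎
  where open ≤-Reasoning
... | no  i≢l  | no  j≢l  = begin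
  crossDist i l (replicate n j) y
    ≡⟨ crossDist-replicate n i≢l (i≢j ∘ sym) j≢l y ⟩
  (2 ^ n + extDist i y) ⊓ suc (2 ^ n + extDist j y)
    ≤⟨ ⊓-glb (m⊓n≤n _ _) (≤-trans (m⊓n≤m _ _) (m≤n⇒m≤1+n (n≤1+n _))) ⟩
  suc ((2 ^ n + extDist j y) ⊓ suc (2 ^ n + extDist i y))
    ≡⟨ cong suc (sym (crossDist-replicate n j≢l i≢j i≢l y)) ⟩
  suc (crossDist j l (replicate n i) y)
    ∎
  where open ≤-Reasoning

dist-lip : {x x′ : Word n} (y : Word n) → SAdj x x′ → dist x y ≤ suc (dist x′ y)
dist-lip (j ∷ y) (inner i e) with i ≟ j
... | yes _ = dist-lip y e
... | no  _ = crossDist-lip i j y e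
dist-lip y (bridge {n} i j i≢j) = dist-lip-bridge n i≢j y

dist≤length : {x y : Word n} → Walk (S n 3) a x y → dist x y ≤ a
dist≤length = lipschitz⇒≤length dist dist-refl dist-lip

-- The cop's strategy

center : ∀ m → Word (2 + m)
center m = 0F ∷ 1F ∷ replicate m 2F

center-eccentricity : ∀ m (b : Word (2 + m)) → DistLe (S (2 + m) 3) (center m) b (3 * 2 ^ m)
center-eccentricity m = reach
  where
  lengths : suc (pred (2 ^ m) + suc (pred (2 ^ suc m))) ≡ 3 * 2 ^ m
  lengths = cong₂ _+_ (suc-pred (2 ^ m) {{m^n≢0 2 m}}) (suc-pred (2 ^ suc m) {{m^n≢0 2 (suc m)}})

  reach : (b : Word (2 + m)) → DistLe (S (2 + m) 3) (center m) b (3 * 2 ^ m)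
  reach (0F ∷ b) =
    DistLe-mono (≤-trans pred[n]≤n (m≤n+m _ (2 ^ m))) (DistLe-∷ 0F (diameter (1F ∷ replicate m 2F) b))
  reach (1F ∷ b) = DistLe-mono (≤-trans (n≤1+n _) (≤-reflexive lengths))
    (DistLe-trans (DistLe-∷ 0F (DistLe-∷ 1F (diameter (replicate m 2F) (replicate m 1F))))
      (DistLe-trans (Step⇒DistLe (inj₂ (bridge 0F 1F λ ())))
        (DistLe-∷ 1F (diameter (replicate (suc m) 0F) b))))
  reach (2F ∷ b) = DistLe-mono (≤-reflexive lengths)
    (DistLe-trans (Step⇒DistLe (inj₂ (inner 0F (bridge 1F 2F λ ()))))
      (DistLe-trans (DistLe-∷ 0F (DistLe-∷ 2F (diameter (replicate m 1F) (replicate m 2F))))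
        (DistLe-trans (Step⇒DistLe (inj₂ (bridge 0F 2F λ ())))
          (DistLe-∷ 2F (diameter (replicate (suc m) 0F) b)))))

cop-wins : ∀ m → CWRC (S (2 + m) 3) (3 * 2 ^ m ∸ 1)
cop-wins m = center⇒CWRC (center m) (DistLe-mono (m≤n+m∸n _ 1) ∘ center-eccentricity m)

-- The robber's strategy

other : Fin 3 → Fin 3
other 0F = 1F
other 1F = 2F
other 2F = 0F

other-≢ : (i : Fin 3) → other i ≢ i
other-≢ 0F ()
other-≢ 1F ()
other-≢ 2F ()

mirror : Fin k → Fin k → Fin k → Fin k
mirror i j l with l ≟ j
... | yes _ = i
... | no  _ = j

map-mirror-replicate-≡ : ∀ n {i j : Fin k} → map (mirror i j) (replicate n j) ≡ replicate n i
map-mirror-replicate-≡ n {i} {j} = trans (map-replicate (mirror i j) j n) (cong (replicate n) mirror-j)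
  where
  mirror-j : mirror i j j ≡ i
  mirror-j with j ≟ j
  ... | yes _   = refl
  ... | no  j≢j = contradiction refl j≢j

map-mirror-replicate-≢ : ∀ n {i j l : Fin k} → l ≢ j → map (mirror i j) (replicate n l) ≡ replicate n j
map-mirror-replicate-≢ n {i} {j} {l} l≢j =
  trans (map-replicate (mirror i j) l n) (cong (replicate n) mirror-l)
  where
  mirror-l : mirror i j l ≡ j
  mirror-l with l ≟ j
  ... | yes l≡j = contradiction l≡j l≢j
  ... | no  _   = refl

hideout : Fin 3 → Word (2 + m)
hideout {m} i = other i ∷ third i (other i) ∷ replicate m (third i (other i))

evade : Word (2 + m) → Word (2 + m)
evade (i ∷ j ∷ x) with i ≟ j
... | yes _ = hideout i
... | no  _ = third i j ∷ j ∷ map (mirror i j) x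

hideout-step : ∀ n {i l : Fin 3} → i ≢ l → Step (S (2 + n) 3) (hideout i) (third i l ∷ l ∷ replicate n l)
hideout-step n {i} {l} i≢l with l ≟ other i
... | yes refl = inj₂ (bridge (other i) (third i (other i)) (third-≢ʳ (other-≢ i ∘ sym) ∘ sym))
... | no  l≢o  = inj₁ (cong₂ (λ a b → a ∷ b ∷ replicate n b)
                             (sym (third-unique i≢l (other-≢ i) (l≢o ∘ sym)))
                             (third-unique (other-≢ i ∘ sym) (i≢l ∘ sym) l≢o))

evade-adj : {c c′ : Word (2 + m)} → SAdj c c′ → Step (S (2 + m) 3) (evade c) (evade c′)
evade-adj (inner i (inner j e)) with i ≟ j
... | yes _ = inj₁ refl
... | no  _ = Step-∷ _ (Step-∷ j (SAdj-map (mirror i j) e))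
evade-adj (inner i (bridge {n} j l j≢l)) with i ≟ j | i ≟ l
... | yes refl | yes refl = contradiction refl j≢l
... | yes refl | no  i≢l  =
  subst (Step (S _ 3) (hideout i)) (cong (λ z → third i l ∷ l ∷ z) (sym (map-mirror-replicate-≢ n i≢l)))
        (hideout-step n i≢l)
... | no  i≢j  | yes refl = Step-sym
  (subst (Step (S _ 3) (hideout i)) (cong (λ z → third i j ∷ j ∷ z) (sym (map-mirror-replicate-≢ n i≢j)))
         (hideout-step n i≢j))
... | no  i≢j  | no  i≢l  = subst₂ (Step (S _ 3))
  (cong₂ (λ a z → a ∷ j ∷ z) (sym (third-unique i≢j (i≢l ∘ sym) l≢j))
                             (sym (map-mirror-replicate-≢ n l≢j)))
  (cong₂ (λ a z → a ∷ l ∷ z) (sym (third-unique i≢l (i≢j ∘ sym) j≢l))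
                             (sym (map-mirror-replicate-≢ n j≢l)))
  (inj₂ (bridge l j l≢j))
  where l≢j = j≢l ∘ sym
evade-adj (bridge {suc m} i j i≢j) with i ≟ j | j ≟ i
... | yes i≡j | _       = contradiction i≡j i≢j
... | no  _   | yes j≡i = contradiction (sym j≡i) i≢j
... | no  _   | no  j≢i = subst₂ (Step (S _ 3))
  (cong (λ z → third i j ∷ j ∷ z) (sym (map-mirror-replicate-≡ m)))
  (cong₂ (λ a z → a ∷ i ∷ z) (sym (third-unique j≢i (third-≢ʳ i≢j) (third-≢ˡ i≢j)))
                             (sym (map-mirror-replicate-≡ m)))
  (inj₂ (inner (third i j) (bridge j i j≢i)))

evade-step : {c c′ : Word (2 + m)} → Step (S (2 + m) 3) c c′ → Step (S (2 + m) 3) (evade c) (evade c′)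
evade-step (inj₁ refl) = inj₁ refl
evade-step (inj₂ e)    = evade-adj e

hideout-far : (i : Fin 3) (x : Word m) → 3 * 2 ^ m ≤ dist (i ∷ i ∷ x) (hideout i)
hideout-far {m} i x = begin
  3 * 2 ^ m                                   ≡⟨⟩
  2 ^ m + 2 ^ suc m
    ≤⟨ ⊓-glb (+-mono-≤ (extDist-≢-≥ i≢o)
                        (≤-reflexive (sym (suc-extDist-replicate-≢ (suc m) (third-≢ˡ i≢o)))))
             (+-mono-≤ (≤-trans (extDist-≢-≥ (third-≢ˡ i≢o ∘ sym)) (m≤m+n _ _)) (n≤1+n _)) ⟩
  crossDist i o (i ∷ x) (replicate (suc m) t) ≡⟨ sym (dist-≢ i≢o) ⟩
  dist (i ∷ i ∷ x) (hideout i)                ∎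
  where
  open ≤-Reasoning
  o = other i
  t = third i o
  i≢o = other-≢ i ∘ sym
  extDist-≢-≥ : {j : Fin 3} → i ≢ j → 2 ^ m ≤ extDist j (i ∷ x)
  extDist-≢-≥ i≢j = ≤-trans (m≤m+n _ _) (≤-reflexive (sym (extDist-≢ i≢j)))

mirror-far : {i j : Fin 3} → i ≢ j → (x : Word m) →
             3 * 2 ^ m ≤ dist (i ∷ j ∷ x) (third i j ∷ j ∷ map (mirror i j) x)
mirror-far {m} {i} {j} i≢j x = begin
  3 * P
    ≤⟨ ⊓-glb direct via ⟩
  (extDist t (j ∷ x) + suc (extDist i (j ∷ y))) ⊓ (extDist j (j ∷ x) + extDist j (j ∷ y) + suc (2 * P))
    ≡⟨ sym (crossDist-via i≢t (i≢j ∘ sym) j≢t (j ∷ x) (j ∷ y)) ⟩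
  crossDist i t (j ∷ x) (j ∷ y)
    ≡⟨ sym (dist-≢ i≢t) ⟩
  dist (i ∷ j ∷ x) (t ∷ j ∷ y)
    ∎
  where
  open ≤-Reasoning
  P = 2 ^ m
  t = third i j
  y = map (mirror i j) x
  i≢t = third-≢ˡ i≢j ∘ sym
  j≢t = third-≢ʳ i≢j ∘ sym

  separates-direct : ∀ l → l ≢ t ⊎ mirror i j l ≢ i
  separates-direct l with l ≟ j
  ... | yes refl = inj₁ j≢t
  ... | no  _    = inj₂ (i≢j ∘ sym)

  separates-via : ∀ l → l ≢ j ⊎ mirror i j l ≢ j
  separates-via l with l ≟ j
  ... | yes _   = inj₂ i≢j
  ... | no  l≢j = inj₁ l≢j

  direct : 3 * P ≤ extDist t (j ∷ x) + suc (extDist i (j ∷ y))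
  direct = begin
    3 * P
      ≤⟨ two-halves (extDist-map-≥ t i (mirror i j) separates-direct x) ⟩
    (P + extDist t x) + suc (P + extDist i y)
      ≡⟨ sym (cong₂ (λ a b → a + suc b) (extDist-≢ j≢t) (extDist-≢ (i≢j ∘ sym))) ⟩
    extDist t (j ∷ x) + suc (extDist i (j ∷ y))
      ∎
    where
    two-halves : ∀ {P a b} → P ≤ suc (a + b) → 3 * P ≤ (P + a) + suc (P + b)
    two-halves {P} {a} {b} h = begin
      3 * P                 ≡⟨ 3P≡P+P+P P ⟩
      P + P + P             ≤⟨ +-monoʳ-≤ (P + P) h ⟩
      P + P + suc (a + b)   ≡⟨ rearrange P a b ⟩
      (P + a) + suc (P + b) ∎
      where
      3P≡P+P+P : ∀ P → 3 * P ≡ P + P + P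
      3P≡P+P+P = solve-∀
      rearrange : ∀ P a b → P + P + suc (a + b) ≡ (P + a) + suc (P + b)
      rearrange = solve-∀

  via : 3 * P ≤ extDist j (j ∷ x) + extDist j (j ∷ y) + suc (2 * P)
  via = begin
    P + 2 * P
      ≤⟨ +-monoˡ-≤ (2 * P) (extDist-map-≥ j j (mirror i j) separates-via x) ⟩
    suc (extDist j x + extDist j y) + 2 * P
      ≡⟨ sym (+-suc _ (2 * P)) ⟩
    extDist j x + extDist j y + suc (2 * P)
      ≡⟨ sym (cong₂ (λ a b → a + b + suc (2 * P)) (extDist-≡ {x = x}) (extDist-≡ {x = y})) ⟩
    extDist j (j ∷ x) + extDist j (j ∷ y) + suc (2 * P)
      ∎

evade-far : (c : Word (2 + m)) → 3 * 2 ^ m ≤ dist c (evade c)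
evade-far (i ∷ j ∷ x) with i ≟ j
... | yes refl = hideout-far i x
... | no  i≢j  = mirror-far i≢j x

CWRC⇒3·2^m≤1+r : ∀ m r → CWRC (S (2 + m) 3) r → 3 * 2 ^ m ≤ suc r
CWRC⇒3·2^m≤1+r m r win = ≮⇒≥ λ 1+r<3·2^m → evasion⇒¬CWRC evade evade-step (far 1+r<3·2^m) win
  where
  far : suc r < 3 * 2 ^ m → (c : Word (2 + m)) → ¬ DistLe (S (2 + m) 3) c (evade c) (suc r)
  far 1+r<3·2^m c (ℓ , ℓ≤1+r , w) = <⇒≱ 1+r<3·2^m (≤-trans (evade-far c) (≤-trans (dist≤length w) ℓ≤1+r))

theorem5p3 : (n : ℕ) → 3 ≤ n → IsRC (S n 3) (3 * 2 ^ (n ∸ 2) ∸ 1)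
theorem5p3 1 (s≤s ())
theorem5p3 (suc (suc m)) _ = cop-wins m , λ r win → ∸-monoˡ-≤ 1 (CWRC⇒3·2^m≤1+r m r win)
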